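{- Let $\mathsf{n}$ be a linearly dependent tuple of linear subspaces of a finite-dimensional vector space $V$ over a field $\mathbb{K}$, and let $\mathsf{m}$ be the unique subtuple of $\mathsf{n}$ that is minimal by inclusion among the subtuples of minimal defect. Then the quotient tuple $\mathsf{n}/\mathsf{m}$ is linearly independent.
   Context: A tuple is a finite indexed family of linear subspaces of $V$ (repetitions allowed); a subtuple is a subfamily indexed by a subset of the index set. For a tuple $\mathsf{k}$, $\langle\mathsf{k}\rangle=\sum_{L\in\mathsf{k}}L$ (zero for the empty tuple), $\mathfrak{c}(\mathsf{k})$ is the number of its entries, and $\delta(\mathsf{k})=\dim\langle\mathsf{k}\rangle-\mathfrak{c}(\mathsf{k})$ is its defect. A tuple is linearly independent if every subtuple (including itself) has non-negative defect, and linearly dependent otherwise. For a subtuple $\mathsf{k}\subseteq\mathsf{n}$, the quotient tuple $\mathsf{n}/\mathsf{k}$ is the tuple of subspaces $(\pi(L))_{L\in\mathsf{n}\setminus\mathsf{k}}$ of $V/\langle\mathsf{k}\rangle$, where $\pi:V\to V/\langle\mathsf{k}\rangle$ is the projection. "Subtuples of minimal defect" means subtuples $\mathsf{k}$ with $\delta(\mathsf{k})=\min_{\mathsf{k}'\subseteq\mathsf{n}}\delta(\mathsf{k}')$. -}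

module Defs where

open import Level using (Level; _⊔_)
open import Algebra.Bundles using (CommutativeRing)
open import Algebra.Module.Bundles.Raw using (RawLeftModule)
open import Data.Nat using (ℕ; zero; suc)
open import Data.Fin using (Fin; zero; suc)
open import Data.Fin.Subset using (Subset; _∈_; _⊆_; ∣_∣; inside; outside)
open import Data.Vec using (_∷_; [])
open import Data.Integer using (ℤ; +_; _-_; _≤_; 0ℤ)
open import Data.Product using (Σ; ∃; _×_)
open import Relation.Nullary using (¬_)
open import Relation.Unary using (Pred)
open import Relation.Binary.PropositionalEquality using (_≡_)
open import Function using (_∘_)

record IsField {c ℓ : Level} (K : CommutativeRing c ℓ) : Set (c ⊔ ℓ) where
  open CommutativeRing K
  field
    1≉0 : ¬ (1# ≈ 0#)
    inverse : ∀ x → ¬ (x ≈ 0#) → ∃ λ y → x * y ≈ 1#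

-- A "tuple" of subspaces is a family  L : Fin N → Pred V  together with an
-- index set  I : Subset N  (the entries of the tuple are L i for i ∈ I);
-- a subtuple is an index set  S ⊆ I.
module Generic {c ℓ m ℓm : Level} (K : CommutativeRing c ℓ)
               (V : RawLeftModule (CommutativeRing.Carrier K) m ℓm) where
  open CommutativeRing K using (Carrier; _≈_; 0#)
  open RawLeftModule V

  lincomb : ∀ {r} → (Fin r → Carrier) → (Fin r → Carrierᴹ) → Carrierᴹ
  lincomb {zero} c b = 0ᴹ
  lincomb {suc r} c b = (c zero *ₗ b zero) +ᴹ lincomb (c ∘ suc) (b ∘ suc)

  LinIndepVecs : ∀ {r} → (Fin r → Carrierᴹ) → Set (c ⊔ ℓ ⊔ ℓm)
  LinIndepVecs b = ∀ c → lincomb c b ≈ᴹ 0ᴹ → ∀ i → c i ≈ 0#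

  Spans : ∀ {p r} → (Fin r → Carrierᴹ) → Pred Carrierᴹ p → Set (c ⊔ m ⊔ ℓm ⊔ p)
  Spans b W = ∀ v → W v → ∃ λ c → v ≈ᴹ lincomb c b

  FiniteDim : Set (c ⊔ m ⊔ ℓm)
  FiniteDim = ∃ λ r → Σ (Fin r → Carrierᴹ) λ b → ∀ v → ∃ λ c → v ≈ᴹ lincomb c b

  HasDim : ∀ {p} → Pred Carrierᴹ p → ℕ → Set (c ⊔ ℓ ⊔ m ⊔ ℓm ⊔ p)
  HasDim W r = Σ (Fin r → Carrierᴹ) λ b → (∀ i → W (b i)) × LinIndepVecs b × Spans b W

  record IsSubspace {p} (W : Pred Carrierᴹ p) : Set (c ⊔ m ⊔ ℓm ⊔ p) where
    field
      resp : ∀ {u v} → u ≈ᴹ v → W u → W v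
      zero∈ : W 0ᴹ
      +∈ : ∀ {u v} → W u → W v → W (u +ᴹ v)
      *∈ : ∀ a {u} → W u → W (a *ₗ u)

  selSum : ∀ {N} → Subset N → (Fin N → Carrierᴹ) → Carrierᴹ
  selSum [] w = 0ᴹ
  selSum (inside ∷ S) w = w zero +ᴹ selSum S (w ∘ suc)
  selSum (outside ∷ S) w = selSum S (w ∘ suc)

  span : ∀ {p N} → (Fin N → Pred Carrierᴹ p) → Subset N → Pred Carrierᴹ (m ⊔ ℓm ⊔ p)
  span L S v = ∃ λ w → (∀ i → i ∈ S → L i (w i)) × v ≈ᴹ selSum S w

  HasDefect : ∀ {p N} → (Fin N → Pred Carrierᴹ p) → Subset N → ℤ → Set (c ⊔ ℓ ⊔ m ⊔ ℓm ⊔ p)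
  HasDefect L S d = ∃ λ r → HasDim (span L S) r × d ≡ (+ r) - (+ ∣ S ∣)

  LinIndepTuple : ∀ {p N} → Subset N → (Fin N → Pred Carrierᴹ p) → Set (c ⊔ ℓ ⊔ m ⊔ ℓm ⊔ p)
  LinIndepTuple I L = ∀ S → S ⊆ I → ∀ d → HasDefect L S d → 0ℤ ≤ d

  MinDefect : ∀ {p N} → Subset N → (Fin N → Pred Carrierᴹ p) → Subset N → Set (c ⊔ ℓ ⊔ m ⊔ ℓm ⊔ p)
  MinDefect I L S = S ⊆ I × ∃ λ d → HasDefect L S d ×
                      (∀ S' → S' ⊆ I → ∀ d' → HasDefect L S' d' → d ≤ d')

  InclMinMinDefect : ∀ {p N} → Subset N → (Fin N → Pred Carrierᴹ p) → Subset N → Set (c ⊔ ℓ ⊔ m ⊔ ℓm ⊔ p)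
  InclMinMinDefect I L S = MinDefect I L S × (∀ S' → S' ⊆ S → MinDefect I L S' → S' ≡ S)

  quotient : ∀ {p} → Pred Carrierᴹ p → RawLeftModule Carrier m p
  quotient U = record
    { Carrierᴹ = Carrierᴹ
    ; _≈ᴹ_ = λ u v → U (u +ᴹ (-ᴹ v))
    ; _+ᴹ_ = _+ᴹ_
    ; _*ₗ_ = _*ₗ_
    ; 0ᴹ = 0ᴹ
    ; -ᴹ_ = -ᴹ_
    }

  -- π(L) ⊆ V/U : the classes of elements of L
  image : ∀ {p q} → Pred Carrierᴹ p → Pred Carrierᴹ q → Pred Carrierᴹ (m ⊔ p ⊔ q)
  image U L v = ∃ λ l → L l × U (v +ᴹ (-ᴹ l))

-- For k disjoint from m, a basis of ⟨m⟩ followed by lifts of a basis of ⟨k/m⟩ ⊆ V/⟨m⟩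
-- is a basis of ⟨k ∪ m⟩, so δ(k ∪ m) = δ(m) + δ(k/m).  As δ(m) is the least defect,
-- δ(k/m) ≥ 0.
module Submission where

open import Level using (Level)
open import Algebra.Bundles using (CommutativeRing; AbelianGroup)
open import Algebra.Module.Bundles using (LeftModule)
open import Algebra.Module.Bundles.Raw using (RawLeftModule)
open import Data.Nat using (ℕ; zero; suc; _+_)
open import Data.Nat.Properties using (+-suc)
open import Data.Fin using (Fin; zero; suc; _↑ˡ_; _↑ʳ_; splitAt)
open import Data.Fin.Properties using (splitAt⁻¹-↑ˡ; splitAt⁻¹-↑ʳ)
open import Data.Fin.Subset using (Subset; ⊤; ∁; _∪_; _∈_; _⊆_; ∣_∣; inside; outside)
open import Data.Fin.Subset.Properties using (p⊆p∪q; q⊆p∪q; ∈⊤; _∈?_; drop-∷-⊆; x∈∁p⇒x∉p)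
open import Data.Vec.Base using ([]; _∷_; here; there)
open import Data.Vec.Functional using (_++_)
open import Data.Vec.Functional.Properties using (lookup-++ˡ; lookup-++ʳ)
open import Data.Vec.Functional.Relation.Unary.All.Properties using (++⁺)
import Data.Integer as ℤ
import Data.Integer.Properties as ℤ
open import Data.Integer.Tactic.RingSolver using (solve-∀)
open import Data.Product using (∃; _×_; _,_; proj₁; proj₂)
open import Data.Sum using (inj₁; inj₂)
open import Function using (_∘_)
open import Relation.Nullary using (¬_; Dec; yes; no; contradiction)
open import Relation.Unary using (Pred)
import Relation.Unary as Unary
open import Relation.Binary.PropositionalEquality
  using (_≡_; _≗_; refl; sym; trans; cong; cong₂; subst; subst₂; module ≡-Reasoning)

open import Defs

↑-elim : ∀ {p m n} {P : Fin (m + n) → Set p} →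
         (∀ i → P (i ↑ˡ n)) → (∀ j → P (m ↑ʳ j)) → ∀ k → P k
↑-elim {m = m} {P = P} left right k with splitAt m k in eq
... | inj₁ i = subst P (splitAt⁻¹-↑ˡ eq) (left i)
... | inj₂ j = subst P (splitAt⁻¹-↑ʳ eq) (right j)

subset-choice : ∀ {a ℓ n} {A : Set a} {P : Fin n → A → Set ℓ} (S : Subset n) → A →
                (∀ i → i ∈ S → ∃ (P i)) → ∃ λ f → ∀ i → i ∈ S → P i (f i)
subset-choice {A = A} {P} S default choose = (λ i → pick i (i ∈? S)) , λ i i∈S → picked i (i ∈? S) i∈S
  where
  pick : ∀ i → Dec (i ∈ S) → A
  pick i (yes i∈S) = proj₁ (choose i i∈S)
  pick i (no _)    = default
  picked : ∀ i (i∈?S : Dec (i ∈ S)) → i ∈ S → P i (pick i i∈?S)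
  picked i (yes i∈S) _   = proj₂ (choose i i∈S)
  picked i (no i∉S) i∈S = contradiction i∈S i∉S

∣p∪q∣≡∣p∣+∣q∣ : ∀ {n} (p q : Subset n) → p ⊆ ∁ q → ∣ p ∪ q ∣ ≡ ∣ p ∣ + ∣ q ∣
∣p∪q∣≡∣p∣+∣q∣ []            []            _    = refl
∣p∪q∣≡∣p∣+∣q∣ (inside ∷ p)  (inside ∷ q)  p⊆∁q = contradiction here (x∈∁p⇒x∉p (p⊆∁q here))
∣p∪q∣≡∣p∣+∣q∣ (inside ∷ p)  (outside ∷ q) p⊆∁q = cong suc (∣p∪q∣≡∣p∣+∣q∣ p q (drop-∷-⊆ p⊆∁q))
∣p∪q∣≡∣p∣+∣q∣ (outside ∷ p) (inside ∷ q)  p⊆∁q =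
  trans (cong suc (∣p∪q∣≡∣p∣+∣q∣ p q (drop-∷-⊆ p⊆∁q))) (sym (+-suc ∣ p ∣ ∣ q ∣))
∣p∪q∣≡∣p∣+∣q∣ (outside ∷ p) (outside ∷ q) p⊆∁q = ∣p∪q∣≡∣p∣+∣q∣ p q (drop-∷-⊆ p⊆∁q)

[+r-+a]+[+r′-+s]≡+[r+r′]-+[s+a] : ∀ r a r′ s →
  (ℤ.+ r ℤ.- ℤ.+ a) ℤ.+ (ℤ.+ r′ ℤ.- ℤ.+ s) ≡ ℤ.+ (r + r′) ℤ.- ℤ.+ (s + a)
[+r-+a]+[+r′-+s]≡+[r+r′]-+[s+a] r a r′ s = begin
  (ℤ.+ r ℤ.- ℤ.+ a) ℤ.+ (ℤ.+ r′ ℤ.- ℤ.+ s) ≡⟨ regroup (ℤ.+ r) (ℤ.+ a) (ℤ.+ r′) (ℤ.+ s) ⟩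
  (ℤ.+ r ℤ.+ ℤ.+ r′) ℤ.- (ℤ.+ s ℤ.+ ℤ.+ a) ≡⟨ cong₂ ℤ._-_ (ℤ.pos-+ r r′) (ℤ.pos-+ s a) ⟨
  ℤ.+ (r + r′) ℤ.- ℤ.+ (s + a)             ∎
  where
  open ≡-Reasoning
  regroup : ∀ i j k l → (i ℤ.- j) ℤ.+ (k ℤ.- l) ≡ (i ℤ.+ k) ℤ.- (l ℤ.+ j)
  regroup = solve-∀

i≤i+j⇒0≤j : ∀ i j → i ℤ.≤ i ℤ.+ j → ℤ.0ℤ ℤ.≤ j
i≤i+j⇒0≤j i j i≤i+j = subst₂ ℤ._≤_ (ℤ.+-inverseˡ i) -i+[i+j]≡j (ℤ.+-monoʳ-≤ (ℤ.- i) i≤i+j)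
  where
  -i+[i+j]≡j : ℤ.- i ℤ.+ (i ℤ.+ j) ≡ j
  -i+[i+j]≡j = trans (sym (ℤ.+-assoc (ℤ.- i) i j))
                     (trans (cong (ℤ._+ j) (ℤ.+-inverseˡ i)) (ℤ.+-identityˡ j))

module _ {c ℓ m ℓm} (K : CommutativeRing c ℓ) (M : RawLeftModule (CommutativeRing.Carrier K) m ℓm) where
  open RawLeftModule M using (Carrierᴹ)
  open Generic K M

  HasDim-resp : ∀ {p q r} {X : Pred Carrierᴹ p} {Y : Pred Carrierᴹ q} → X Unary.≐ Y → HasDim X r → HasDim Y r
  HasDim-resp (X⊆Y , Y⊆X) (b , b∈X , b-indep , b-spans) = b , X⊆Y ∘ b∈X , b-indep , λ v → b-spans v ∘ Y⊆X

module LeftModuleTheory {c ℓ m ℓm} (K : CommutativeRing c ℓ)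
                        (V : LeftModule (CommutativeRing.ring K) m ℓm) where
  open CommutativeRing K using (Carrier; _≈_; 0#; 1#; -‿inverseʳ) renaming (_+_ to _+K_; -_ to -K_)
  open LeftModule V
  open Generic K rawLeftModule
  open import Algebra.Properties.AbelianGroup +ᴹ-abelianGroup
    using (inverseʳ-unique; ε⁻¹≈ε; ⁻¹-∙-comm; xyx⁻¹≈y; //-rightDividesˡ; \\-leftDividesʳ)
  open import Algebra.Properties.CommutativeSemigroup (AbelianGroup.commutativeSemigroup +ᴹ-abelianGroup)
    using (interchange)
  open import Relation.Binary.Reasoning.Setoid ≈ᴹ-setoid

  -1*ₗx≈-ᴹx : ∀ x → (-K 1#) *ₗ x ≈ᴹ -ᴹ x
  -1*ₗx≈-ᴹx x = inverseʳ-unique x _ (begin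
    x +ᴹ (-K 1#) *ₗ x       ≈⟨ +ᴹ-congʳ (*ₗ-identityˡ x) ⟨
    1# *ₗ x +ᴹ (-K 1#) *ₗ x ≈⟨ *ₗ-distribʳ x 1# (-K 1#) ⟨
    (1# +K -K 1#) *ₗ x      ≈⟨ *ₗ-congʳ (-‿inverseʳ 1#) ⟩
    0# *ₗ x                 ≈⟨ *ₗ-zeroˡ x ⟩
    0ᴹ                      ∎)

  module _ {q} {W : Pred Carrierᴹ q} (W-sub : IsSubspace W) where
    open IsSubspace W-sub

    -ᴹ∈ : ∀ {x} → W x → W (-ᴹ x)
    -ᴹ∈ {x} x∈W = resp (-1*ₗx≈-ᴹx x) (*∈ (-K 1#) x∈W)

    x-x∈ : ∀ x → W (x +ᴹ -ᴹ x)
    x-x∈ x = resp (≈ᴹ-sym (-ᴹ‿inverseʳ x)) zero∈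

    selSum∈ : ∀ {N} (S : Subset N) w → (∀ i → i ∈ S → W (w i)) → W (selSum S w)
    selSum∈ []            w w∈W = zero∈
    selSum∈ (inside ∷ S)  w w∈W = +∈ (w∈W zero here) (selSum∈ S (w ∘ suc) (λ i → w∈W (suc i) ∘ there))
    selSum∈ (outside ∷ S) w w∈W = selSum∈ S (w ∘ suc) (λ i → w∈W (suc i) ∘ there)

    lincomb∈ : ∀ {r} (a : Fin r → Carrier) b → (∀ j → W (b j)) → W (lincomb a b)
    lincomb∈ {zero}  a b b∈W = zero∈
    lincomb∈ {suc r} a b b∈W = +∈ (*∈ (a zero) (b∈W zero)) (lincomb∈ (a ∘ suc) (b ∘ suc) (b∈W ∘ suc))

  selSum-0 : ∀ {N} (S : Subset N) → selSum S (λ _ → 0ᴹ) ≈ᴹ 0ᴹ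
  selSum-0 []            = ≈ᴹ-refl
  selSum-0 (inside ∷ S)  = ≈ᴹ-trans (+ᴹ-identityˡ _) (selSum-0 S)
  selSum-0 (outside ∷ S) = selSum-0 S

  selSum-+ : ∀ {N} (S : Subset N) w v → selSum S (λ i → w i +ᴹ v i) ≈ᴹ selSum S w +ᴹ selSum S v
  selSum-+ []            w v = ≈ᴹ-sym (+ᴹ-identityˡ 0ᴹ)
  selSum-+ (inside ∷ S)  w v = ≈ᴹ-trans (+ᴹ-congˡ (selSum-+ S (w ∘ suc) (v ∘ suc))) (interchange _ _ _ _)
  selSum-+ (outside ∷ S) w v = selSum-+ S (w ∘ suc) (v ∘ suc)

  selSum-* : ∀ {N} (S : Subset N) a w → selSum S (λ i → a *ₗ w i) ≈ᴹ a *ₗ selSum S w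
  selSum-* []            a w = ≈ᴹ-sym (*ₗ-zeroʳ a)
  selSum-* (inside ∷ S)  a w = ≈ᴹ-trans (+ᴹ-congˡ (selSum-* S a (w ∘ suc))) (≈ᴹ-sym (*ₗ-distribˡ a _ _))
  selSum-* (outside ∷ S) a w = selSum-* S a (w ∘ suc)

  selSum-neg : ∀ {N} (S : Subset N) w → selSum S (λ i → -ᴹ w i) ≈ᴹ -ᴹ selSum S w
  selSum-neg []            w = ≈ᴹ-sym ε⁻¹≈ε
  selSum-neg (inside ∷ S)  w = ≈ᴹ-trans (+ᴹ-congˡ (selSum-neg S (w ∘ suc))) (⁻¹-∙-comm _ _)
  selSum-neg (outside ∷ S) w = selSum-neg S (w ∘ suc)

  selSum-∪ : ∀ {N} (S T : Subset N) → S ⊆ ∁ T → ∀ w → selSum (S ∪ T) w ≈ᴹ selSum S w +ᴹ selSum T w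
  selSum-∪ []            []            _    w = ≈ᴹ-sym (+ᴹ-identityˡ 0ᴹ)
  selSum-∪ (inside ∷ S)  (inside ∷ T)  S⊆∁T w = contradiction here (x∈∁p⇒x∉p (S⊆∁T here))
  selSum-∪ (inside ∷ S)  (outside ∷ T) S⊆∁T w =
    ≈ᴹ-trans (+ᴹ-congˡ (selSum-∪ S T (drop-∷-⊆ S⊆∁T) (w ∘ suc))) (≈ᴹ-sym (+ᴹ-assoc _ _ _))
  selSum-∪ (outside ∷ S) (inside ∷ T)  S⊆∁T w = begin
    w zero +ᴹ selSum (S ∪ T) (w ∘ suc)          ≈⟨ +ᴹ-congˡ (selSum-∪ S T (drop-∷-⊆ S⊆∁T) (w ∘ suc)) ⟩
    w zero +ᴹ (selSum S (w ∘ suc) +ᴹ selSum T (w ∘ suc)) ≈⟨ +ᴹ-assoc _ _ _ ⟨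
    (w zero +ᴹ selSum S (w ∘ suc)) +ᴹ selSum T (w ∘ suc) ≈⟨ +ᴹ-congʳ (+ᴹ-comm _ _) ⟩
    (selSum S (w ∘ suc) +ᴹ w zero) +ᴹ selSum T (w ∘ suc) ≈⟨ +ᴹ-assoc _ _ _ ⟩
    selSum S (w ∘ suc) +ᴹ (w zero +ᴹ selSum T (w ∘ suc)) ∎
  selSum-∪ (outside ∷ S) (outside ∷ T) S⊆∁T w = selSum-∪ S T (drop-∷-⊆ S⊆∁T) (w ∘ suc)

  -ᴹ-telescope : ∀ x y z → (x +ᴹ -ᴹ y) +ᴹ (y +ᴹ -ᴹ z) ≈ᴹ x +ᴹ -ᴹ z
  -ᴹ-telescope x y z = ≈ᴹ-trans (+ᴹ-assoc _ _ _) (+ᴹ-congˡ (\\-leftDividesʳ y (-ᴹ z)))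

  restrict : ∀ {N} → Subset N → (Fin N → Carrierᴹ) → Fin N → Carrierᴹ
  restrict (_ ∷ S)       w (suc i) = restrict S (w ∘ suc) i
  restrict (inside ∷ S)  w zero    = w zero
  restrict (outside ∷ S) w zero    = 0ᴹ

  selSum-restrict : ∀ {N} (S S′ : Subset N) → S ⊆ S′ → ∀ w → selSum S′ (restrict S w) ≈ᴹ selSum S w
  selSum-restrict []            []             _     w = ≈ᴹ-refl
  selSum-restrict (inside ∷ S)  (inside ∷ S′)  S⊆S′ w =
    +ᴹ-congˡ (selSum-restrict S S′ (drop-∷-⊆ S⊆S′) (w ∘ suc))
  selSum-restrict (inside ∷ S)  (outside ∷ S′) S⊆S′ w with S⊆S′ here
  ... | ()
  selSum-restrict (outside ∷ S) (inside ∷ S′)  S⊆S′ w =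
    ≈ᴹ-trans (+ᴹ-identityˡ _) (selSum-restrict S S′ (drop-∷-⊆ S⊆S′) (w ∘ suc))
  selSum-restrict (outside ∷ S) (outside ∷ S′) S⊆S′ w = selSum-restrict S S′ (drop-∷-⊆ S⊆S′) (w ∘ suc)

  restrict∈ : ∀ {p N} (L : Fin N → Pred Carrierᴹ p) → (∀ i → L i 0ᴹ) →
              ∀ S {w} → (∀ i → i ∈ S → L i (w i)) → ∀ i → L i (restrict S w i)
  restrict∈ L 0∈L (inside ∷ S)  w∈L zero    = w∈L zero here
  restrict∈ L 0∈L (outside ∷ S) w∈L zero    = 0∈L zero
  restrict∈ L 0∈L (_ ∷ S)       w∈L (suc i) = restrict∈ (L ∘ suc) (0∈L ∘ suc) S (λ j → w∈L (suc j) ∘ there) i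

  module _ {p N} (L : Fin N → Pred Carrierᴹ p) (L-sub : ∀ i → IsSubspace (L i)) where

    span-isSubspace : ∀ S → IsSubspace (span L S)
    span-isSubspace S = record
      { resp  = λ { u≈v (w , w∈L , u≈Σw) → w , w∈L , ≈ᴹ-trans (≈ᴹ-sym u≈v) u≈Σw }
      ; zero∈ = (λ _ → 0ᴹ) , (λ i _ → IsSubspace.zero∈ (L-sub i)) , ≈ᴹ-sym (selSum-0 S)
      ; +∈    = λ { (w , w∈L , u≈Σw) (v , v∈L , u′≈Σv) →
                    (λ i → w i +ᴹ v i) , (λ i i∈S → IsSubspace.+∈ (L-sub i) (w∈L i i∈S) (v∈L i i∈S)) ,
                    ≈ᴹ-trans (+ᴹ-cong u≈Σw u′≈Σv) (≈ᴹ-sym (selSum-+ S w v)) }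
      ; *∈    = λ { a (w , w∈L , u≈Σw) → (λ i → a *ₗ w i) , (λ i i∈S → IsSubspace.*∈ (L-sub i) a (w∈L i i∈S)) ,
                    ≈ᴹ-trans (*ₗ-congˡ u≈Σw) (≈ᴹ-sym (selSum-* S a w)) }
      }

    span-mono : ∀ {S S′} → S ⊆ S′ → ∀ {x} → span L S x → span L S′ x
    span-mono {S} {S′} S⊆S′ (w , w∈L , x≈Σw) =
      restrict S w , (λ i _ → restrict∈ L (IsSubspace.zero∈ ∘ L-sub) S w∈L i) ,
      ≈ᴹ-trans x≈Σw (≈ᴹ-sym (selSum-restrict S S′ S⊆S′ w))

    span-∪⁺ : ∀ S T {x y} → span L S x → span L T y → span L (S ∪ T) (x +ᴹ y)
    span-∪⁺ S T x∈ y∈ =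
      IsSubspace.+∈ (span-isSubspace (S ∪ T)) (span-mono (p⊆p∪q T) x∈) (span-mono (q⊆p∪q S T) y∈)

  lincomb-cong : ∀ {r} {a a′ : Fin r → Carrier} {b b′ : Fin r → Carrierᴹ} →
                 a ≗ a′ → b ≗ b′ → lincomb a b ≡ lincomb a′ b′
  lincomb-cong {zero}  _    _    = refl
  lincomb-cong {suc r} a≗a′ b≗b′ =
    cong₂ _+ᴹ_ (cong₂ _*ₗ_ (a≗a′ zero) (b≗b′ zero)) (lincomb-cong (a≗a′ ∘ suc) (b≗b′ ∘ suc))

  lincomb-zero : ∀ {r} (a : Fin r → Carrier) b → (∀ j → a j ≈ 0#) → lincomb a b ≈ᴹ 0ᴹ
  lincomb-zero {zero}  a b a≈0 = ≈ᴹ-refl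
  lincomb-zero {suc r} a b a≈0 = ≈ᴹ-trans
    (+ᴹ-cong (≈ᴹ-trans (*ₗ-congʳ (a≈0 zero)) (*ₗ-zeroˡ _)) (lincomb-zero (a ∘ suc) (b ∘ suc) (a≈0 ∘ suc)))
    (+ᴹ-identityˡ 0ᴹ)

  lincomb-split : ∀ {r r′} (a : Fin (r + r′) → Carrier) b →
    lincomb a b ≈ᴹ lincomb (a ∘ (_↑ˡ r′)) (b ∘ (_↑ˡ r′)) +ᴹ lincomb (a ∘ (r ↑ʳ_)) (b ∘ (r ↑ʳ_))
  lincomb-split {zero}  a b = ≈ᴹ-sym (+ᴹ-identityˡ _)
  lincomb-split {suc r} a b =
    ≈ᴹ-trans (+ᴹ-congˡ (lincomb-split {r} (a ∘ suc) (b ∘ suc))) (≈ᴹ-sym (+ᴹ-assoc _ _ _))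

  lincomb-++ : ∀ {r r′} (a : Fin (r + r′) → Carrier) (b : Fin r → Carrierᴹ) (b′ : Fin r′ → Carrierᴹ) →
    lincomb a (b ++ b′) ≈ᴹ lincomb (a ∘ (_↑ˡ r′)) b +ᴹ lincomb (a ∘ (r ↑ʳ_)) b′
  lincomb-++ {r} a b b′ = ≈ᴹ-trans (lincomb-split {r} a (b ++ b′)) (≈ᴹ-reflexive
    (cong₂ _+ᴹ_ (lincomb-cong (λ _ → refl) (lookup-++ˡ b b′)) (lincomb-cong (λ _ → refl) (lookup-++ʳ b b′))))

  module Quotient {u} {U : Pred Carrierᴹ u} (U-sub : IsSubspace U) where
    module Q = Generic K (quotient U)
    open IsSubspace U-sub using () renaming (resp to U-resp; +∈ to U-+∈)

    selSum-quotient : ∀ {N} (S : Subset N) w → Q.selSum S w ≡ selSum S w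
    selSum-quotient []            w = refl
    selSum-quotient (inside ∷ S)  w = cong (w zero +ᴹ_) (selSum-quotient S (w ∘ suc))
    selSum-quotient (outside ∷ S) w = selSum-quotient S (w ∘ suc)

    lincomb-quotient : ∀ {r} (a : Fin r → Carrier) b → Q.lincomb a b ≡ lincomb a b
    lincomb-quotient {zero}  a b = refl
    lincomb-quotient {suc r} a b = cong (a zero *ₗ b zero +ᴹ_) (lincomb-quotient (a ∘ suc) (b ∘ suc))

    span-image⇒ : ∀ {p N} {L : Fin N → Pred Carrierᴹ p} {S v} →
                  Q.span (image U ∘ L) S v → ∃ λ x → span L S x × U (v +ᴹ -ᴹ x)
    span-image⇒ {N = N} {L} {S} {v} (w , w∈L/U , v-Σw∈U) =
      selSum S l , (l , (λ i i∈S → proj₁ (l-chosen i i∈S)) , ≈ᴹ-refl) ,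
      U-resp (-ᴹ-telescope v (selSum S w) (selSum S l)) (U-+∈ v-Σw∈U′ Σw-Σl∈U)
      where
      choice : ∃ λ l → ∀ i → i ∈ S → L i (l i) × U (w i +ᴹ -ᴹ l i)
      choice = subset-choice S 0ᴹ w∈L/U
      l : Fin N → Carrierᴹ
      l = proj₁ choice
      l-chosen : ∀ i → i ∈ S → L i (l i) × U (w i +ᴹ -ᴹ l i)
      l-chosen = proj₂ choice
      v-Σw∈U′ : U (v +ᴹ -ᴹ selSum S w)
      v-Σw∈U′ = subst (λ z → U (v +ᴹ -ᴹ z)) (selSum-quotient S w) v-Σw∈U
      Σw-Σl∈U : U (selSum S w +ᴹ -ᴹ selSum S l)
      Σw-Σl∈U = U-resp (≈ᴹ-trans (selSum-+ S w (-ᴹ_ ∘ l)) (+ᴹ-congˡ (selSum-neg S l)))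
                       (selSum∈ U-sub S _ (λ i i∈S → proj₂ (l-chosen i i∈S)))

    ⇒span-image : ∀ {p N} {L : Fin N → Pred Carrierᴹ p} {S x v} →
                  span L S x → U (v +ᴹ -ᴹ x) → Q.span (image U ∘ L) S v
    ⇒span-image {S = S} {v = v} (w , w∈L , x≈Σw) v-x∈U =
      w , (λ i i∈S → w i , w∈L i i∈S , x-x∈ U-sub (w i)) ,
      subst (λ z → U (v +ᴹ -ᴹ z)) (sym (selSum-quotient S w))
            (U-resp (+ᴹ-congˡ (-ᴹ‿cong x≈Σw)) v-x∈U)

    ++-independent : ∀ {r r′} {b : Fin r → Carrierᴹ} {b′ : Fin r′ → Carrierᴹ} →
                     (∀ j → U (b j)) → LinIndepVecs b → Q.LinIndepVecs b′ → LinIndepVecs (b ++ b′)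
    ++-independent {r} {r′} {b} {b′} b∈U b-indep b′-indep a Σ≈0 =
      ↑-elim {P = λ k → a k ≈ 0#} a-left≈0 a-right≈0
      where
      x y : Carrierᴹ
      x = lincomb (a ∘ (_↑ˡ r′)) b
      y = lincomb (a ∘ (r ↑ʳ_)) b′
      x+y≈0 : x +ᴹ y ≈ᴹ 0ᴹ
      x+y≈0 = ≈ᴹ-trans (≈ᴹ-sym (lincomb-++ a b b′)) Σ≈0
      -x≈y-0 : -ᴹ x ≈ᴹ y +ᴹ -ᴹ 0ᴹ
      -x≈y-0 = begin
        -ᴹ x        ≈⟨ inverseʳ-unique x y x+y≈0 ⟨
        y           ≈⟨ +ᴹ-identityʳ y ⟨
        y +ᴹ 0ᴹ     ≈⟨ +ᴹ-congˡ ε⁻¹≈ε ⟨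
        y +ᴹ -ᴹ 0ᴹ  ∎
      y-0∈U : U (Q.lincomb (a ∘ (r ↑ʳ_)) b′ +ᴹ -ᴹ 0ᴹ)
      y-0∈U = subst (λ z → U (z +ᴹ -ᴹ 0ᴹ)) (sym (lincomb-quotient _ b′))
                    (U-resp -x≈y-0 (-ᴹ∈ U-sub (lincomb∈ U-sub _ b b∈U)))
      a-right≈0 : ∀ j → a (r ↑ʳ j) ≈ 0#
      a-right≈0 = b′-indep _ y-0∈U
      a-left≈0 : ∀ i → a (i ↑ˡ r′) ≈ 0#
      a-left≈0 = b-indep _ (begin
        x          ≈⟨ +ᴹ-identityʳ x ⟨
        x +ᴹ 0ᴹ    ≈⟨ +ᴹ-congˡ (lincomb-zero _ b′ a-right≈0) ⟨
        x +ᴹ y     ≈⟨ x+y≈0 ⟩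
        0ᴹ         ∎)

    ++-spans : ∀ {w r r′} {W : Pred Carrierᴹ w} {b : Fin r → Carrierᴹ} {b′ : Fin r′ → Carrierᴹ} →
               Spans b U → Q.Spans b′ W → Spans (b ++ b′) W
    ++-spans {b = b} {b′} b-spans b′-spans v v∈W =
      let (e , v-Σe∈U) = b′-spans v v∈W
          (a , v-Σe≈Σa) = b-spans _ (subst (λ z → U (v +ᴹ -ᴹ z)) (lincomb-quotient e b′) v-Σe∈U)
      in a ++ e , (begin
        v                                      ≈⟨ //-rightDividesˡ (lincomb e b′) v ⟨
        (v +ᴹ -ᴹ lincomb e b′) +ᴹ lincomb e b′ ≈⟨ +ᴹ-congʳ v-Σe≈Σa ⟩
        lincomb a b +ᴹ lincomb e b′
          ≡⟨ cong₂ _+ᴹ_ (lincomb-cong (sym ∘ lookup-++ˡ a e) (λ _ → refl))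
                        (lincomb-cong (sym ∘ lookup-++ʳ a e) (λ _ → refl)) ⟩
        lincomb ((a ++ e) ∘ (_↑ˡ _)) b +ᴹ lincomb ((a ++ e) ∘ (_ ↑ʳ_)) b′
          ≈⟨ lincomb-++ (a ++ e) b b′ ⟨
        lincomb (a ++ e) (b ++ b′)             ∎)

    HasDim-extend : ∀ {w r r′} {W : Pred Carrierᴹ w} →
                    Unary._⊆_ U W → HasDim U r → Q.HasDim W r′ → HasDim W (r + r′)
    HasDim-extend {W = W} U⊆W (b , b∈U , b-indep , b-spans) (b′ , b′∈W , b′-indep , b′-spans) =
      b ++ b′ , ++⁺ W (U⊆W ∘ b∈U) b′∈W , ++-independent b∈U b-indep b′-indep , ++-spans b-spans b′-spans

  module _ {p N} (L : Fin N → Pred Carrierᴹ p) (L-sub : ∀ i → IsSubspace (L i)) {T : Subset N} where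
    open Quotient (span-isSubspace L L-sub T)

    span-image≐span-∪ : ∀ {S} → S ⊆ ∁ T → Q.span (image (span L T) ∘ L) S Unary.≐ span L (S ∪ T)
    span-image≐span-∪ {S} S⊆∁T = span-image⊆ , ⊆span-image
      where
      span-image⊆ : Unary._⊆_ (Q.span (image (span L T) ∘ L) S) (span L (S ∪ T))
      span-image⊆ {v} v∈ =
        let (x , x∈⟨S⟩ , v-x∈⟨T⟩) = span-image⇒ v∈
        in IsSubspace.resp (span-isSubspace L L-sub (S ∪ T))
             (≈ᴹ-trans (+ᴹ-comm x _) (//-rightDividesˡ x v)) (span-∪⁺ L L-sub S T x∈⟨S⟩ v-x∈⟨T⟩)
      ⊆span-image : Unary._⊆_ (span L (S ∪ T)) (Q.span (image (span L T) ∘ L) S)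
      ⊆span-image {v} (w , w∈L , v≈Σw) =
        ⇒span-image (w , (λ i → w∈L i ∘ p⊆p∪q T) , ≈ᴹ-refl) (w , (λ i → w∈L i ∘ q⊆p∪q S T) , (begin
          v +ᴹ -ᴹ selSum S w                          ≈⟨ +ᴹ-congʳ (≈ᴹ-trans v≈Σw (selSum-∪ S T S⊆∁T w)) ⟩
          (selSum S w +ᴹ selSum T w) +ᴹ -ᴹ selSum S w ≈⟨ xyx⁻¹≈y (selSum S w) (selSum T w) ⟩
          selSum T w                                  ∎))

    HasDefect-∪ : ∀ {S d₀ d} → S ⊆ ∁ T → HasDefect L T d₀ → Q.HasDefect (image (span L T) ∘ L) S d →
                  HasDefect L (S ∪ T) (d₀ ℤ.+ d)
    HasDefect-∪ {S} S⊆∁T (r , dim⟨T⟩ , refl) (r′ , dim⟨S/T⟩ , refl) =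
      r + r′ ,
      HasDim-extend (span-mono L L-sub (q⊆p∪q S T)) dim⟨T⟩
        (HasDim-resp K (quotient (span L T)) (span-image≐span-∪ S⊆∁T) dim⟨S/T⟩) ,
      defect-+
      where
      defect-+ : (ℤ.+ r ℤ.- ℤ.+ ∣ T ∣) ℤ.+ (ℤ.+ r′ ℤ.- ℤ.+ ∣ S ∣) ≡ ℤ.+ (r + r′) ℤ.- ℤ.+ ∣ S ∪ T ∣
      defect-+ = trans ([+r-+a]+[+r′-+s]≡+[r+r′]-+[s+a] r (∣ T ∣) r′ (∣ S ∣))
                       (cong (λ s → ℤ.+ (r + r′) ℤ.- ℤ.+ s) (sym (∣p∪q∣≡∣p∣+∣q∣ S T S⊆∁T)))

corollary2p14 : ∀ {c ℓ m ℓm p : Level} (K : CommutativeRing c ℓ) → IsField K →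
    (V : LeftModule (CommutativeRing.ring K) m ℓm) →
    Generic.FiniteDim K (LeftModule.rawLeftModule V) →
    ∀ {N : ℕ} (n : Fin N → Pred (LeftModule.Carrierᴹ V) p) →
    (∀ i → Generic.IsSubspace K (LeftModule.rawLeftModule V) (n i)) →
    ¬ Generic.LinIndepTuple K (LeftModule.rawLeftModule V) ⊤ n →
    (mm : Subset N) →
    Generic.InclMinMinDefect K (LeftModule.rawLeftModule V) ⊤ n mm →
    Generic.LinIndepTuple K
      (Generic.quotient K (LeftModule.rawLeftModule V) (Generic.span K (LeftModule.rawLeftModule V) n mm))
      (∁ mm)
      (λ i → Generic.image K (LeftModule.rawLeftModule V) (Generic.span K (LeftModule.rawLeftModule V) n mm) (n i))
corollary2p14 K _ V _ n n-sub _ mm ((_ , δm , mm-defect , δm-least) , _) S S⊆∁mm δ S/mm-defect =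
  i≤i+j⇒0≤j δm δ (δm-least (S ∪ mm) (λ _ → ∈⊤) (δm ℤ.+ δ) (HasDefect-∪ n n-sub S⊆∁mm mm-defect S/mm-defect))
  where open LeftModuleTheory K V
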